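{- Let $r\ge1$, $X=[r]$, and let $U$ be a bipartitional relation on $X$ associated with the ordered bipartition $((B_1,\dots,B_k),(\beta_1,\dots,\beta_k))$. Then the statistics $\mathrm{maj}_U$ and $\mathrm{inv}_U$ are equidistributed on each rearrangement class $R(\mathbf c)$ (i.e. for every $\mathbf c$ and every integer $k$, $\#\{w\in R(\mathbf c):\mathrm{maj}_U w=k\}=\#\{w\in R(\mathbf c):\mathrm{inv}_U w=k\}$) if and only if $U$ is compatible.
   Context: Words are finite sequences $w=x_1\cdots x_m$ of letters of $X$; for $\mathbf c=(c(1),\dots,c(r))$ of non-negative integers, $R(\mathbf c)$ is the set of words with exactly $c(i)$ occurrences of $i$ for each $i$. An ordered bipartition of $X$ is a sequence $(B_1,\dots,B_k)$ of non-empty pairwise disjoint subsets with union $X$ together with $(\beta_1,\dots,\beta_k)\in\{0,1\}^k$; $B_l$ (and each of its elements) is underlined iff $\beta_l=1$. The associated bipartitional relation $U$: $(x,y)\in U$ iff $x\in B_l,y\in B_{l'}$ with $l<l'$, or $x,y\in B_l$ with $\beta_l=1$. $U$ is compatible if $(\beta_1,\dots,\beta_k)$ has the form $(1,\dots,1,0,\dots,0)$ (all underlined blocks to the left of all non-underlined ones). With $\chi(A)\in\{0,1\}$ the truth value of $A$ and $|w|_-$ the number of underlined letters of $w$, define for $w=x_1\cdots x_m$: $\mathrm{maj}_U w=\sum_{i=1}^{m-1} i\,\chi((x_i,x_{i+1})\in U)+m\,\chi(x_m\text{ is underlined})$ and $\mathrm{inv}_U w=\sum_{1\le i<j\le m}\chi((x_i,x_j)\in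 U)+|w|_-$. -}

module Defs where

open import Data.Nat using (ℕ; zero; suc; _+_; _*_; _<_; _<ᵇ_; _≡ᵇ_)
open import Data.Fin using (Fin; toℕ)
open import Data.Bool using (Bool; true; false; _∧_; _∨_; if_then_else_)
open import Data.List using (List; []; _∷_; length; filterᵇ; concatMap; map; allFin)
open import Data.Product using (∃; _,_)
open import Relation.Binary.PropositionalEquality using (_≡_)

-- An ordered bipartition ((B_1,…,B_k),(β_1,…,β_k)) of X: the ordered
-- sequence of non-empty pairwise disjoint blocks with union X is encoded by
-- the block-index map  block : X → Fin k  (x ∈ B_{block x}), which must be
-- surjective (every block non-empty); β gives the underlining of each block.
record OrderedBipartition (r : ℕ) : Set where
  field
    k        : ℕ
    block    : Fin r → Fin k
    nonempty : ∀ (l : Fin k) → ∃ λ (x : Fin r) → block x ≡ l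
    β        : Fin k → Bool

open OrderedBipartition public

module _ {r : ℕ} (P : OrderedBipartition r) where

  χ : Bool → ℕ
  χ true  = 1
  χ false = 0

  underlined : Fin r → Bool
  underlined x = β P (block P x)

  U : Fin r → Fin r → Bool
  U x y = (toℕ (block P x) <ᵇ toℕ (block P y))
        ∨ ((toℕ (block P x) ≡ᵇ toℕ (block P y)) ∧ β P (block P x))

  majFrom : ℕ → List (Fin r) → ℕ
  majFrom i []             = 0
  majFrom i (x ∷ [])       = i * χ (underlined x)
  majFrom i (x ∷ y ∷ rest) = i * χ (U x y) + majFrom (suc i) (y ∷ rest)

  majU : List (Fin r) → ℕ
  majU w = majFrom 1 w

  invWith : Fin r → List (Fin r) → ℕ
  invWith x []       = 0
  invWith x (y ∷ ys) = χ (U x y) + invWith x ys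

  invU : List (Fin r) → ℕ
  invU []       = 0
  invU (x ∷ xs) = invWith x xs + χ (underlined x) + invU xs

  -- Compatible: (β_1,…,β_k) has the form (1,…,1,0,…,0)
  Compatible : Set
  Compatible = ∀ (l l' : Fin (k P)) → toℕ l < toℕ l' →
               β P l ≡ false → β P l' ≡ false

occ : {r : ℕ} → Fin r → List (Fin r) → ℕ
occ i []       = 0
occ i (x ∷ xs) = (if toℕ i ≡ᵇ toℕ x then 1 else 0) + occ i xs

sumFin : {r : ℕ} → (Fin r → ℕ) → ℕ
sumFin {zero}  c = 0
sumFin {suc r} c = c Fin.zero + sumFin (λ i → c (Fin.suc i))
  where import Data.Fin as Fin

wordsOfLength : (r m : ℕ) → List (List (Fin r))
wordsOfLength r zero    = [] ∷ []
wordsOfLength r (suc m) = concatMap (λ x → map (x ∷_) (wordsOfLength r m)) (allFin r)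

inRᵇ : {r : ℕ} → (Fin r → ℕ) → List (Fin r) → Bool
inRᵇ {r} c w = allᵇ (allFin r)
  where
  allᵇ : List (Fin r) → Bool
  allᵇ []       = true
  allᵇ (i ∷ is) = (occ i w ≡ᵇ c i) ∧ allᵇ is

R : {r : ℕ} → (Fin r → ℕ) → List (List (Fin r))
R {r} c = filterᵇ (inRᵇ c) (wordsOfLength r (sumFin c))

countStat : {r : ℕ} → (List (Fin r) → ℕ) → (Fin r → ℕ) → ℕ → ℕ
countStat stat c n = length (filterᵇ (λ w → stat w ≡ᵇ n) (R c))

Equidistributed : {r : ℕ} → OrderedBipartition r → Set
Equidistributed {r} P =
  ∀ (c : Fin r → ℕ) (n : ℕ) → countStat (majU P) c n ≡ countStat (invU P) c n

{-# OPTIONS --safe #-}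

-- Write inv and maj for the inversion number and major index that count only pairs in U.
-- Then inv_U w = inv w + |w|₋ and maj_U w = maj w + |w| χ(last letter of w underlined).
-- Say U separates a predicate p if (a, b) ∈ U ⇔ p a whenever p a ≠ p b.  Cutting w into
-- factors that end in a letter with the same p-value as the last letter of w, and moving that
-- letter to the front of each factor, gives a rearrangement γ_p w with
-- inv (γ_p w) + #p w = inv w + |w| χ(p (last letter of w)).  U separates every column
-- (· U x), so Foata's map foata (w x) = γ_(· U x) (foata w) x turns maj into inv; if U is
-- compatible it also separates the underlined letters, and a last γ turns the final term of
-- maj_U into |w|₋.  Conversely, if a non-underlined block B_l precedes an underlined B_l′,
-- then for x ∈ B_l and y ∈ B_l′ the word x y has maj_U = 3, while no rearrangement of x y
-- has inv_U = 3.

module Submission where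

open import Defs

open import Data.Bool using (Bool; true; false; not; T; T?; if_then_else_; _∧_; _∨_)
open import Data.Bool.ListAction using (all)
open import Data.Bool.Properties using (¬-not; _≟_; T-≡; T-∧)
open import Data.Fin using (Fin; toℕ)
import Data.Fin as Fin
open import Data.Fin.Properties using (toℕ-injective)
open import Data.List
  using (List; []; _∷_; _++_; _∷ʳ_; [_]; length; map; reverse; filterᵇ; concatMap;
         cartesianProductWith; allFin; initLast; _∷ʳ′_)
open import Data.List.Membership.Propositional using (_∈_)
open import Data.List.Membership.Propositional.Properties
  using (∈-∃++; ∈-map⁻; ∈-allFin; ∈-cartesianProductWith⁺; ∈-filter⁺; ∈-filter⁻)
open import Data.List.Properties
  using (∷-injective; map-++; map-cong; length-map; length-++; length-reverse; ∷ʳ-++; ∷ʳ-injective;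
         unfold-reverse; reverse-involutive; reverse-injective; filter-none)
open import Data.List.Relation.Binary.Permutation.Propositional
  using (_↭_; prep; ↭-refl; ↭-reflexive; ↭-sym; ↭-trans)
open import Data.List.Relation.Binary.Permutation.Propositional.Properties
  using (filter-↭; ∈-resp-↭; ++⁺ˡ; shift; ∷↭∷ʳ; ↭-length; ↭-reverse)
import Data.List.Relation.Binary.Permutation.Propositional.Properties as ↭
open import Data.List.Relation.Unary.All as All using (All; []; _∷_)
open import Data.List.Relation.Unary.All.Properties using (all⁺; all⁻; tabulate⁺)
open import Data.List.Relation.Unary.Any using (here; there)
open import Data.List.Relation.Unary.Unique.Propositional using (Unique; []; _∷_)
import Data.List.Relation.Unary.Unique.Propositional.Properties as Unique
open import Data.Nat using (ℕ; zero; suc; _+_; _*_; _<_; _≤_; _<ᵇ_; _≡ᵇ_; s≤s⁻¹)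
open import Data.Nat.ListAction using (sum)
open import Data.Nat.ListAction.Properties using (sum-++; sum-↭)
open import Data.Nat.Properties
  using (+-commutativeSemigroup; +-comm; +-identityʳ; *-zeroʳ; ≡⇒≡ᵇ; ≡ᵇ⇒≡; <⇒<ᵇ; <ᵇ⇒<; <⇒≤; <⇒≱;
         ≤-reflexive; <-≤-trans; <-cmp)
open import Data.Nat.Tactic.RingSolver using (solve-∀)
open import Algebra.Properties.CommutativeSemigroup +-commutativeSemigroup
  using () renaming (interchange to +-interchange)
open import Data.Product using (_×_; _,_; proj₁; proj₂)
open import Function using (_∘_; Equivalence; _⇔_; mk⇔)
open import Function.Definitions using (Injective)
open import Level using (0ℓ)
open import Relation.Binary.Definitions using (tri<; tri≈; tri>)
open import Relation.Binary.PropositionalEquality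
  using (_≡_; _≢_; refl; sym; trans; cong; cong₂; subst; subst₂; module ≡-Reasoning)
open import Relation.Nullary using (¬_; yes; no; does; contradiction)
open import Relation.Nullary.Decidable using (dec-true; dec-false)
open import Relation.Unary using (Pred; Decidable)

𝟙 : Bool → ℕ
𝟙 b = if b then 1 else 0

count : {A : Set} → (A → Bool) → List A → ℕ
count p = sum ∘ map (𝟙 ∘ p)

module _ {A : Set} (p : A → Bool) where

  count-++ : ∀ xs ys → count p (xs ++ ys) ≡ count p xs + count p ys
  count-++ xs ys = trans (cong sum (map-++ (𝟙 ∘ p) xs ys)) (sum-++ (map (𝟙 ∘ p) xs) _)

  count-↭ : ∀ {xs ys} → xs ↭ ys → count p xs ≡ count p ys
  count-↭ xs↭ys = sum-↭ (↭.map⁺ (𝟙 ∘ p) xs↭ys)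

  count-const : ∀ {b xs} → All (λ x → p x ≡ b) xs → count p xs ≡ length xs * 𝟙 b
  count-const []           = refl
  count-const (refl ∷ pxs) = cong (_ +_) (count-const pxs)

count-cong : {A : Set} {p q : A → Bool} {xs : List A} →
             All (λ x → p x ≡ q x) xs → count p xs ≡ count q xs
count-cong []       = refl
count-cong (e ∷ es) = cong₂ _+_ (cong 𝟙 e) (count-cong es)

∷ʳ≢[] : {A : Set} (xs : List A) {x : A} → xs ∷ʳ x ≢ []
∷ʳ≢[] [] ()
∷ʳ≢[] (_ ∷ _) ()

-- cycle moves the last letter b of each factor C b (no letter of C in P, b in P) to the front
-- of that factor.
module Cycling {A : Set} {P : Pred A 0ℓ} (P? : Decidable P) where

  cycleWith : List A → List A → List A
  cycleWith pending []       = pending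
  cycleWith pending (b ∷ bs) =
    if does (P? b) then b ∷ pending ++ cycleWith [] bs else cycleWith (pending ∷ʳ b) bs

  cycle : List A → List A
  cycle = cycleWith []

  data Factors : List A → Set where
    []     : Factors []
    factor : ∀ {C b rest} → All (¬_ ∘ P) C → P b → Factors rest → Factors (C ++ b ∷ rest)

  factors-∷ʳ : ∀ v {b} → P b → Factors (v ∷ʳ b)
  factors-∷ʳ []      Pb = factor [] Pb []
  factors-∷ʳ (c ∷ v) Pb with P? c
  ... | yes Pc = factor [] Pc (factors-∷ʳ v Pb)
  ... | no ¬Pc = prepend (factors-∷ʳ v Pb) (∷ʳ≢[] v)
    where
    prepend : ∀ {u} → Factors u → u ≢ [] → Factors (c ∷ u)
    prepend []                 u≢[] = contradiction refl u≢[]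
    prepend (factor ¬PC Pb fs) _    = factor (¬Pc ∷ ¬PC) Pb fs

  cycleWith-factor : ∀ pending {C b} rest → All (¬_ ∘ P) C → P b →
                     cycleWith pending (C ++ b ∷ rest) ≡ b ∷ pending ++ C ++ cycle rest
  cycleWith-factor pending rest [] Pb rewrite dec-true (P? _) Pb = refl
  cycleWith-factor pending {c ∷ C} rest (¬Pc ∷ ¬PC) Pb rewrite dec-false (P? c) ¬Pc =
    trans (cycleWith-factor (pending ∷ʳ c) rest ¬PC Pb) (cong (_ ∷_) (∷ʳ-++ pending c _))

  cycle-factor : ∀ {C b} rest → All (¬_ ∘ P) C → P b → cycle (C ++ b ∷ rest) ≡ b ∷ C ++ cycle rest
  cycle-factor = cycleWith-factor []

  cycle-↭ : ∀ {u} → Factors u → cycle u ↭ u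
  cycle-↭ []                                = ↭-refl
  cycle-↭ (factor {C} {b} {rest} ¬PC Pb fs) = ↭-trans (↭-reflexive (cycle-factor rest ¬PC Pb))
    (↭-trans (prep b (++⁺ˡ C (cycle-↭ fs))) (↭-sym (shift b C rest)))

  uncycleFrom : A → List A → List A
  uncycleFrom h []       = [ h ]
  uncycleFrom h (b ∷ bs) = if does (P? b) then h ∷ uncycleFrom b bs else b ∷ uncycleFrom h bs

  uncycleFrom-++ : ∀ h {C} xs → All (¬_ ∘ P) C → uncycleFrom h (C ++ xs) ≡ C ++ uncycleFrom h xs
  uncycleFrom-++ h xs []                      = refl
  uncycleFrom-++ h xs (_∷_ {c} ¬Pc ¬PC) rewrite dec-false (P? c) ¬Pc =
    cong (c ∷_) (uncycleFrom-++ h xs ¬PC)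

  uncycleFrom-cycle : ∀ h {u} → Factors u → uncycleFrom h (cycle u) ≡ h ∷ u
  uncycleFrom-cycle h [] = refl
  uncycleFrom-cycle h (factor {C} {b} {rest} ¬PC Pb fs)
    rewrite cycle-factor rest ¬PC Pb | dec-true (P? b) Pb =
    cong (h ∷_) (trans (uncycleFrom-++ b _ ¬PC) (cong (C ++_) (uncycleFrom-cycle b fs)))

lastIs : {A : Set} → (A → Bool) → List A → Bool
lastIs p []           = false
lastIs p (x ∷ [])     = p x
lastIs p (_ ∷ y ∷ ys) = lastIs p (y ∷ ys)

lastIs-∷ʳ : {A : Set} (p : A → Bool) (xs : List A) (x : A) → lastIs p (xs ∷ʳ x) ≡ p x
lastIs-∷ʳ p []           x = refl
lastIs-∷ʳ p (_ ∷ [])     x = refl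
lastIs-∷ʳ p (_ ∷ y ∷ ys) x = lastIs-∷ʳ p (y ∷ ys) x

shift-weight : ∀ n a b k l →
  suc n * a + (b + (suc n + suc k) * l) ≡ (suc n * a + b) + (n + suc (suc k)) * l
shift-weight = solve-∀

module Foata {A : Set} (_◁_ : A → A → Bool) where

  inv : List A → ℕ
  inv []       = 0
  inv (x ∷ xs) = count (x ◁_) xs + inv xs

  cross : List A → List A → ℕ
  cross xs ys = sum (map (λ x → count (x ◁_) ys) xs)

  inv-++ : ∀ xs ys → inv (xs ++ ys) ≡ inv xs + cross xs ys + inv ys
  inv-++ []       ys = refl
  inv-++ (x ∷ xs) ys = begin
    count (x ◁_) (xs ++ ys) + inv (xs ++ ys)
      ≡⟨ cong₂ _+_ (count-++ (x ◁_) xs ys) (inv-++ xs ys) ⟩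
    (count (x ◁_) xs + count (x ◁_) ys) + (inv xs + cross xs ys + inv ys)
      ≡⟨ shuffle (count (x ◁_) xs) (count (x ◁_) ys) (inv xs) (cross xs ys) (inv ys) ⟩
    (count (x ◁_) xs + inv xs) + (count (x ◁_) ys + cross xs ys) + inv ys ∎
    where
    open ≡-Reasoning
    shuffle : ∀ a b c d e → (a + b) + (c + d + e) ≡ (a + c) + (b + d) + e
    shuffle = solve-∀

  cross-↭ : ∀ {xs xs′ ys ys′} → xs ↭ xs′ → ys ↭ ys′ → cross xs ys ≡ cross xs′ ys′
  cross-↭ {xs} xs↭xs′ ys↭ys′ =
    trans (cong sum (map-cong (λ x → count-↭ (x ◁_) ys↭ys′) xs)) (sum-↭ (↭.map⁺ _ xs↭xs′))

  inv-∷ʳ : ∀ xs y → inv (xs ∷ʳ y) ≡ inv xs + count (_◁ y) xs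
  inv-∷ʳ xs y = trans (inv-++ xs [ y ]) (trans (+-identityʳ _) (cong (inv xs +_) cross-singleton))
    where
    cross-singleton : cross xs [ y ] ≡ count (_◁ y) xs
    cross-singleton = cong sum (map-cong (λ x → +-identityʳ (𝟙 (x ◁ y))) xs)

  -- the major index of a word preceded by n letters: the pair at positions (i, i + 1) weighs n + i
  majAfter : ℕ → List A → ℕ
  majAfter n []           = 0
  majAfter n (_ ∷ [])     = 0
  majAfter n (x ∷ y ∷ ys) = suc n * 𝟙 (x ◁ y) + majAfter (suc n) (y ∷ ys)

  maj : List A → ℕ
  maj = majAfter 0

  maj-∷ʳ : ∀ n ys z → majAfter n (ys ∷ʳ z) ≡ majAfter n ys + (n + length ys) * 𝟙 (lastIs (_◁ z) ys)
  maj-∷ʳ n []           z = sym (*-zeroʳ (n + 0))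
  maj-∷ʳ n (y ∷ [])     z = trans (+-identityʳ _) (cong (_* 𝟙 (y ◁ z)) (+-comm 1 n))
  maj-∷ʳ n (y ∷ y′ ∷ ys) z =
    trans (cong (suc n * 𝟙 (y ◁ y′) +_) (maj-∷ʳ (suc n) (y′ ∷ ys) z))
          (shift-weight n (𝟙 (y ◁ y′)) _ (length ys) _)

  Separates : (A → Bool) → Set
  Separates p = ∀ {a b} → p a ≢ p b → a ◁ b ≡ p a

  module _ (p : A → Bool) where

    -- inv u′ = inv u + |u| 𝟙 q − #p u, stated without subtraction
    InvShift : Bool → List A → List A → Set
    InvShift q u u′ = inv u′ + count p u ≡ inv u + length u * 𝟙 q

    invShift-++ : ∀ {q u₁ u₁′ u₂ u₂′} → u₁′ ↭ u₁ → u₂′ ↭ u₂ →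
                  InvShift q u₁ u₁′ → InvShift q u₂ u₂′ → InvShift q (u₁ ++ u₂) (u₁′ ++ u₂′)
    invShift-++ {q} {u₁} {u₁′} {u₂} {u₂′} π₁ π₂ e₁ e₂ = begin
      inv (u₁′ ++ u₂′) + count p (u₁ ++ u₂)
        ≡⟨ cong₂ _+_ (inv-++ u₁′ u₂′) (count-++ p u₁ u₂) ⟩
      inv u₁′ + cross u₁′ u₂′ + inv u₂′ + (count p u₁ + count p u₂)
        ≡⟨ regroup (inv u₁′) (cross u₁′ u₂′) (inv u₂′) (count p u₁) (count p u₂) ⟩
      (inv u₁′ + count p u₁) + (inv u₂′ + count p u₂) + cross u₁′ u₂′
        ≡⟨ cong₂ _+_ (cong₂ _+_ e₁ e₂) (cross-↭ π₁ π₂) ⟩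
      (inv u₁ + length u₁ * 𝟙 q) + (inv u₂ + length u₂ * 𝟙 q) + cross u₁ u₂
        ≡⟨ ungroup (inv u₁) (cross u₁ u₂) (inv u₂) (length u₁) (length u₂) (𝟙 q) ⟩
      inv u₁ + cross u₁ u₂ + inv u₂ + (length u₁ + length u₂) * 𝟙 q
        ≡⟨ sym (cong₂ _+_ (inv-++ u₁ u₂) (cong (_* 𝟙 q) (length-++ u₁))) ⟩
      inv (u₁ ++ u₂) + length (u₁ ++ u₂) * 𝟙 q ∎
      where
      open ≡-Reasoning
      regroup : ∀ a b c d e → a + b + c + (d + e) ≡ (a + d) + (c + e) + b
      regroup = solve-∀
      ungroup : ∀ a b c l m k → (a + l * k) + (c + m * k) + b ≡ a + b + c + (l + m) * k
      ungroup = solve-∀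

    -- moving b in front of C trades the count p C pairs (c, b) ∈ _◁_ for the
    -- length C * 𝟙 (p b) pairs (b, c) ∈ _◁_
    invShift-factor : Separates p → ∀ {b C} → All (λ c → p c ≢ p b) C →
                      InvShift (p b) (C ∷ʳ b) (b ∷ C)
    invShift-factor sep {b} {C} C≢b = begin
      count (b ◁_) C + inv C + count p (C ∷ʳ b)
        ≡⟨ cong₂ _+_ (cong (_+ inv C) (count-const (b ◁_) (All.map (λ ≢b → sep (≢b ∘ sym)) C≢b)))
                     (count-++ p C [ b ]) ⟩
      length C * 𝟙 (p b) + inv C + (count p C + (𝟙 (p b) + 0))
        ≡⟨ regroup (length C) (inv C) (count p C) (𝟙 (p b)) ⟩
      inv C + count p C + (length C + 1) * 𝟙 (p b)
        ≡⟨ sym (cong₂ _+_ (trans (inv-∷ʳ C b) (cong (inv C +_) (count-cong (All.map sep C≢b))))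
                          (cong (_* 𝟙 (p b)) (length-++ C))) ⟩
      inv (C ∷ʳ b) + length (C ∷ʳ b) * 𝟙 (p b) ∎
      where
      open ≡-Reasoning
      regroup : ∀ l a c k → l * k + a + (c + (k + 0)) ≡ a + c + (l + 1) * k
      regroup = solve-∀

    open Cycling using (Factors; []; factor; factors-∷ʳ; cycle; cycle-factor; cycle-↭)
    open Cycling using (uncycleFrom; uncycleFrom-++; uncycleFrom-cycle)

    cycle-invShift : Separates p → ∀ {q u} → Factors (λ a → p a ≟ q) u →
                     InvShift q u (cycle (λ a → p a ≟ q) u)
    cycle-invShift sep []                                  = refl
    cycle-invShift sep (factor {C} {b} {rest} C≢b refl fs) =
      subst₂ (InvShift (p b)) (∷ʳ-++ C b rest) (sym (cycle-factor _ rest C≢b refl))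
        (invShift-++ (∷↭∷ʳ b C) (cycle-↭ _ fs) (invShift-factor sep C≢b) (cycle-invShift sep fs))

    γ : List A → List A
    γ u = cycle (λ a → p a ≟ lastIs p u) u

    γ-factors : ∀ u → Factors (λ a → p a ≟ lastIs p u) u
    γ-factors u with initLast u
    ... | []       = []
    ... | v ∷ʳ′ b = factors-∷ʳ _ v (sym (lastIs-∷ʳ p v b))

    γ-↭ : ∀ u → γ u ↭ u
    γ-↭ u = cycle-↭ _ (γ-factors u)

    inv-γ : Separates p → ∀ u → inv (γ u) + count p u ≡ inv u + length u * 𝟙 (lastIs p u)
    inv-γ sep u = cycle-invShift sep (γ-factors u)

    -- the first letter of γ u has the p-value of the last letter of u
    γ⁻¹ : List A → List A
    γ⁻¹ []      = []
    γ⁻¹ (h ∷ t) = uncycleFrom (λ a → p a ≟ p h) h t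

    γ⁻¹-cycle : ∀ {q u} → Factors (λ a → p a ≟ q) u → γ⁻¹ (cycle (λ a → p a ≟ q) u) ≡ u
    γ⁻¹-cycle []                                  = refl
    γ⁻¹-cycle (factor {C} {b} {rest} C≢b refl fs) =
      trans (cong γ⁻¹ (cycle-factor _ rest C≢b refl))
            (trans (uncycleFrom-++ _ b _ C≢b) (cong (C ++_) (uncycleFrom-cycle _ b fs)))

    γ-injective : ∀ {u u′} → γ u ≡ γ u′ → u ≡ u′
    γ-injective {u} {u′} e = begin
      u             ≡⟨ sym (γ⁻¹-cycle (γ-factors u)) ⟩
      γ⁻¹ (γ u)     ≡⟨ cong γ⁻¹ e ⟩
      γ⁻¹ (γ u′)    ≡⟨ γ⁻¹-cycle (γ-factors u′) ⟩
      u′            ∎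
      where open ≡-Reasoning

  foataʳ : List A → List A
  foataʳ []       = []
  foataʳ (x ∷ rs) = γ (_◁ x) (foataʳ rs) ∷ʳ x

  foata : List A → List A
  foata w = foataʳ (reverse w)

  foataʳ-injective : ∀ {rs rs′} → foataʳ rs ≡ foataʳ rs′ → rs ≡ rs′
  foataʳ-injective {[]}     {[]}      _ = refl
  foataʳ-injective {[]}     {_ ∷ _}   e = contradiction (sym e) (∷ʳ≢[] _)
  foataʳ-injective {_ ∷ _}  {[]}      e = contradiction e (∷ʳ≢[] _)
  foataʳ-injective {x ∷ rs} {_ ∷ rs′} e with ∷ʳ-injective _ _ e
  ... | γ≡γ′ , refl = cong (x ∷_) (foataʳ-injective (γ-injective (_◁ x) γ≡γ′))

  foata-injective : ∀ {w w′} → foata w ≡ foata w′ → w ≡ w′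
  foata-injective = reverse-injective ∘ foataʳ-injective

  lastIs-foataʳ : ∀ p rs → lastIs p (foataʳ rs) ≡ lastIs p (reverse rs)
  lastIs-foataʳ p []       = refl
  lastIs-foataʳ p (x ∷ rs) = begin
    lastIs p (γ (_◁ x) (foataʳ rs) ∷ʳ x) ≡⟨ lastIs-∷ʳ p (γ (_◁ x) (foataʳ rs)) x ⟩
    p x                                  ≡⟨ sym (lastIs-∷ʳ p (reverse rs) x) ⟩
    lastIs p (reverse rs ∷ʳ x)           ≡⟨ cong (lastIs p) (sym (unfold-reverse x rs)) ⟩
    lastIs p (reverse (x ∷ rs))          ∎
    where open ≡-Reasoning

  lastIs-foata : ∀ p w → lastIs p (foata w) ≡ lastIs p w
  lastIs-foata p w = trans (lastIs-foataʳ p (reverse w)) (cong (lastIs p) (reverse-involutive w))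

  foataʳ-↭ : ∀ rs → foataʳ rs ↭ rs
  foataʳ-↭ []       = ↭-refl
  foataʳ-↭ (x ∷ rs) = ↭-trans (↭-sym (∷↭∷ʳ x _)) (prep x (↭-trans (γ-↭ (_◁ x) _) (foataʳ-↭ rs)))

  foata-↭ : ∀ w → foata w ↭ w
  foata-↭ w = ↭-trans (foataʳ-↭ (reverse w)) (↭-reverse w)

  module _ (columns-separate : ∀ x → Separates (_◁ x)) where

    inv-foataʳ : ∀ rs → inv (foataʳ rs) ≡ maj (reverse rs)
    inv-foataʳ []       = refl
    inv-foataʳ (x ∷ rs) = begin
      inv (γx v ∷ʳ x)
        ≡⟨ inv-∷ʳ (γx v) x ⟩
      inv (γx v) + count (_◁ x) (γx v)
        ≡⟨ cong (inv (γx v) +_) (count-↭ (_◁ x) (γ-↭ (_◁ x) v)) ⟩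
      inv (γx v) + count (_◁ x) v
        ≡⟨ inv-γ (_◁ x) (columns-separate x) v ⟩
      inv v + length v * 𝟙 (lastIs (_◁ x) v)
        ≡⟨ cong₂ (λ m l → m + l * 𝟙 (lastIs (_◁ x) v)) (inv-foataʳ rs) length-v ⟩
      maj sr + length sr * 𝟙 (lastIs (_◁ x) v)
        ≡⟨ cong (λ b → maj sr + length sr * 𝟙 b) (lastIs-foataʳ (_◁ x) rs) ⟩
      maj sr + length sr * 𝟙 (lastIs (_◁ x) sr)
        ≡⟨ maj-∷ʳ 0 sr x ⟨
      maj (sr ∷ʳ x)
        ≡⟨ cong maj (unfold-reverse x rs) ⟨
      maj (reverse (x ∷ rs)) ∎
      where
      open ≡-Reasoning
      v sr : List A
      v = foataʳ rs
      sr = reverse rs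
      γx : List A → List A
      γx = γ (_◁ x)
      length-v : length v ≡ length sr
      length-v = trans (↭-length (foataʳ-↭ rs)) (sym (length-reverse rs))

    inv-foata : ∀ w → inv (foata w) ≡ maj w
    inv-foata w = trans (inv-foataʳ (reverse w)) (cong maj (reverse-involutive w))

module _ {r : ℕ} (P : OrderedBipartition r) where

  open Foata (U P)

  -- U P x y unfolds to block P x ⊲ block P y
  _⊲_ : Fin (k P) → Fin (k P) → Bool
  l ⊲ m = (toℕ l <ᵇ toℕ m) ∨ ((toℕ l ≡ᵇ toℕ m) ∧ β P l)

  ⊲-< : ∀ {l m} → toℕ l < toℕ m → l ⊲ m ≡ true
  ⊲-< l<m rewrite Equivalence.to T-≡ (<⇒<ᵇ l<m) = refl

  ⊲⇒≤ : ∀ {l m} → l ⊲ m ≡ true → toℕ l ≤ toℕ m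
  ⊲⇒≤ {l} {m} l⊲m with toℕ l <ᵇ toℕ m in l<ᵇm
  ... | true  = <⇒≤ (<ᵇ⇒< _ _ (Equivalence.from T-≡ l<ᵇm))
  ... | false = ≤-reflexive (≡ᵇ⇒≡ _ _ (proj₁ (Equivalence.to T-∧ (Equivalence.from T-≡ l⊲m))))

  ⊲-> : ∀ {l m} → toℕ m < toℕ l → l ⊲ m ≡ false
  ⊲-> m<l = ¬-not (λ l⊲m → <⇒≱ m<l (⊲⇒≤ l⊲m))

  -- Compatible P unfolds to Antitone (β P)
  Antitone : (Fin (k P) → Bool) → Set
  Antitone f = ∀ l l′ → toℕ l < toℕ l′ → f l ≡ false → f l′ ≡ false

  antitone-≢ : ∀ {f l l′} → Antitone f → toℕ l < toℕ l′ → f l ≢ f l′ → f l ≡ true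
  antitone-≢ anti l<l′ fl≢fl′ =
    ¬-not (λ fl≡false → fl≢fl′ (trans fl≡false (sym (anti _ _ l<l′ fl≡false))))

  antitone⇒separates : ∀ {f} → Antitone f → Separates (f ∘ block P)
  antitone⇒separates {f} anti {a} {b} fa≢fb with <-cmp (toℕ (block P a)) (toℕ (block P b))
  ... | tri< a<b _ _ = trans (⊲-< a<b) (sym (antitone-≢ anti a<b fa≢fb))
  ... | tri≈ _ a≡b _ = contradiction (cong f (toℕ-injective a≡b)) fa≢fb
  ... | tri> _ _ b<a =
    trans (⊲-> b<a) (sym (trans (¬-not fa≢fb) (cong not (antitone-≢ anti b<a (fa≢fb ∘ sym)))))

  columns-separate : ∀ x → Separates (λ a → U P a x)
  columns-separate x = antitone⇒separates {f = _⊲ block P x} λ l l′ l<l′ l⊲x≡false →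
    ¬-not (λ l′⊲x → contradiction (trans (sym (⊲-< (<-≤-trans l<l′ (⊲⇒≤ l′⊲x)))) l⊲x≡false) λ ())

  compatible⇒separates-underlined : Compatible P → Separates (underlined P)
  compatible⇒separates-underlined = antitone⇒separates

  χ≡𝟙 : ∀ b → χ P b ≡ 𝟙 b
  χ≡𝟙 true  = refl
  χ≡𝟙 false = refl

  invWith≡count : ∀ x ys → invWith P x ys ≡ count (U P x) ys
  invWith≡count x []       = refl
  invWith≡count x (y ∷ ys) = cong₂ _+_ (χ≡𝟙 (U P x y)) (invWith≡count x ys)

  invU≡inv+count : ∀ w → invU P w ≡ inv w + count (underlined P) w
  invU≡inv+count []       = refl
  invU≡inv+count (x ∷ xs) =
    trans (cong₂ _+_ (cong₂ _+_ (invWith≡count x xs) (χ≡𝟙 (underlined P x))) (invU≡inv+count xs))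
          (+-interchange (count (U P x) xs) (𝟙 (underlined P x)) (inv xs) (count (underlined P) xs))

  majFrom≡majAfter : ∀ n w →
    majFrom P (suc n) w ≡ majAfter n w + (n + length w) * 𝟙 (lastIs (underlined P) w)
  majFrom≡majAfter n []           = sym (*-zeroʳ (n + 0))
  majFrom≡majAfter n (x ∷ [])     =
    trans (cong (suc n *_) (χ≡𝟙 (underlined P x))) (cong (_* 𝟙 (underlined P x)) (+-comm 1 n))
  majFrom≡majAfter n (x ∷ y ∷ ys) =
    trans (cong₂ _+_ (cong (suc n *_) (χ≡𝟙 (U P x y))) (majFrom≡majAfter (suc n) (y ∷ ys)))
          (shift-weight n (𝟙 (U P x y)) _ (length ys) _)

  majU≡maj+last : ∀ w → majU P w ≡ maj w + length w * 𝟙 (lastIs (underlined P) w)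
  majU≡maj+last = majFrom≡majAfter 0

  Φ : List (Fin r) → List (Fin r)
  Φ w = γ (underlined P) (foata w)

  Φ-↭ : ∀ w → Φ w ↭ w
  Φ-↭ w = ↭-trans (γ-↭ (underlined P) (foata w)) (foata-↭ w)

  Φ-injective : ∀ {w w′} → Φ w ≡ Φ w′ → w ≡ w′
  Φ-injective = foata-injective ∘ γ-injective (underlined P)

  invU-Φ : Compatible P → ∀ w → invU P (Φ w) ≡ majU P w
  invU-Φ compatible w = begin
    invU P (Φ w)                            ≡⟨ invU≡inv+count (Φ w) ⟩
    inv (γ ul v) + count ul (γ ul v)        ≡⟨ cong (inv (γ ul v) +_) (count-↭ ul (γ-↭ ul v)) ⟩
    inv (γ ul v) + count ul v               ≡⟨ inv-γ ul (compatible⇒separates-underlined compatible) v ⟩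
    inv v + length v * 𝟙 (lastIs ul v)      ≡⟨ cong₂ (λ m l → m + l * 𝟙 (lastIs ul v))
                                                     (inv-foata columns-separate w) (↭-length (foata-↭ w)) ⟩
    maj w + length w * 𝟙 (lastIs ul v)      ≡⟨ cong (λ b → maj w + length w * 𝟙 b) (lastIs-foata ul w) ⟩
    maj w + length w * 𝟙 (lastIs ul w)      ≡⟨ sym (majU≡maj+last w) ⟩
    majU P w                                ∎
    where
    open ≡-Reasoning
    ul : Fin r → Bool
    ul = underlined P
    v : List (Fin r)
    v = foata w

unique-⊆⇒↭ : {A : Set} {xs ys : List A} → Unique xs → (∀ {z} → z ∈ xs → z ∈ ys) →
             length ys ≤ length xs → xs ↭ ys
unique-⊆⇒↭ {xs = []}     {[]}    _               _     _     = ↭-refl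
unique-⊆⇒↭ {xs = []}     {_ ∷ _} _               _     ()
unique-⊆⇒↭ {xs = x ∷ xs} (x∉xs ∷ xs!) xs⊆ys ys≤xs with ∈-∃++ (xs⊆ys (here refl))
... | as , bs , refl =
  ↭-trans (prep x (unique-⊆⇒↭ xs! xs⊆as++bs as++bs≤xs)) (↭-sym (shift x as bs))
  where
  as++bs≤xs : length (as ++ bs) ≤ length xs
  as++bs≤xs = s≤s⁻¹ (subst (_≤ length (x ∷ xs)) (↭-length (shift x as bs)) ys≤xs)

  xs⊆as++bs : ∀ {z} → z ∈ xs → z ∈ as ++ bs
  xs⊆as++bs z∈xs with ∈-resp-↭ (shift x as bs) (xs⊆ys (there z∈xs))
  ... | here z≡x = contradiction (sym z≡x) (All.lookup x∉xs z∈xs)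
  ... | there z∈as++bs = z∈as++bs

length-filterᵇ-map : {A B : Set} (p : B → Bool) (q : A → Bool) (f : A → B) → (∀ x → p (f x) ≡ q x) →
                     ∀ xs → length (filterᵇ p (map f xs)) ≡ length (filterᵇ q xs)
length-filterᵇ-map p q f pf≗q []       = refl
length-filterᵇ-map p q f pf≗q (x ∷ xs) rewrite pf≗q x with q x
... | true  = cong suc (length-filterᵇ-map p q f pf≗q xs)
... | false = length-filterᵇ-map p q f pf≗q xs

sumFin-zero : ∀ {r} → sumFin {r} (λ _ → 0) ≡ 0
sumFin-zero {zero}  = refl
sumFin-zero {suc r} = sumFin-zero {r}

sumFin-cong : ∀ {r} {f g : Fin r → ℕ} → (∀ i → f i ≡ g i) → sumFin f ≡ sumFin g
sumFin-cong {zero}  f≗g = refl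
sumFin-cong {suc r} f≗g = cong₂ _+_ (f≗g Fin.zero) (sumFin-cong (f≗g ∘ Fin.suc))

sumFin-+ : ∀ {r} (f g : Fin r → ℕ) → sumFin (λ i → f i + g i) ≡ sumFin f + sumFin g
sumFin-+ {zero}  f g = refl
sumFin-+ {suc r} f g =
  trans (cong (f Fin.zero + g Fin.zero +_) (sumFin-+ (f ∘ Fin.suc) (g ∘ Fin.suc)))
        (+-interchange (f Fin.zero) (g Fin.zero) _ _)

sumFin-indicator : ∀ {r} (x : Fin r) → sumFin {r} (λ i → 𝟙 (toℕ i ≡ᵇ toℕ x)) ≡ 1
sumFin-indicator {suc r} Fin.zero    = cong suc (sumFin-zero {r})
sumFin-indicator {suc r} (Fin.suc x) = sumFin-indicator x

sumFin-occ : ∀ {r} (w : List (Fin r)) → sumFin (λ i → occ i w) ≡ length w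
sumFin-occ {r} []   = sumFin-zero {r}
sumFin-occ (x ∷ xs) =
  trans (sumFin-+ (λ i → 𝟙 (toℕ i ≡ᵇ toℕ x)) (λ i → occ i xs))
        (cong₂ _+_ (sumFin-indicator x) (sumFin-occ xs))

occ≡count : ∀ {r} (i : Fin r) w → occ i w ≡ count (λ x → toℕ i ≡ᵇ toℕ x) w
occ≡count i []       = refl
occ≡count i (x ∷ xs) = cong (𝟙 (toℕ i ≡ᵇ toℕ x) +_) (occ≡count i xs)

occ-↭ : ∀ {r} (i : Fin r) {w w′} → w ↭ w′ → occ i w ≡ occ i w′
occ-↭ i {w} {w′} w↭w′ = trans (occ≡count i w) (trans (count-↭ _ w↭w′) (sym (occ≡count i w′)))

occ≢0⇒∈ : ∀ {r} {i : Fin r} w → occ i w ≢ 0 → i ∈ w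
occ≢0⇒∈           []       occ≢0 = contradiction refl occ≢0
occ≢0⇒∈ {i = i} (x ∷ xs) occ≢0 with toℕ i ≡ᵇ toℕ x in i≡ᵇx
... | true  = here (toℕ-injective (≡ᵇ⇒≡ _ _ (Equivalence.from T-≡ i≡ᵇx)))
... | false = there (occ≢0⇒∈ xs occ≢0)

occ-head≢0 : ∀ {r} (i : Fin r) w → occ i (i ∷ w) ≢ 0
occ-head≢0 i w rewrite Equivalence.to T-≡ (≡⇒≡ᵇ (toℕ i) (toℕ i) refl) = λ ()

concatMap-map≡cartesianProductWith : {A B C : Set} (f : A → B → C) (xs : List A) (ys : List B) →
  concatMap (λ x → map (f x) ys) xs ≡ cartesianProductWith f xs ys
concatMap-map≡cartesianProductWith f []       ys = refl
concatMap-map≡cartesianProductWith f (x ∷ xs) ys =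
  cong (map (f x) ys ++_) (concatMap-map≡cartesianProductWith f xs ys)

module _ {r : ℕ} where

  wordsOfLength-suc : ∀ m → wordsOfLength r (suc m) ≡ cartesianProductWith _∷_ (allFin r) (wordsOfLength r m)
  wordsOfLength-suc m = concatMap-map≡cartesianProductWith _∷_ (allFin r) (wordsOfLength r m)

  ∈-wordsOfLength⁺ : ∀ w → w ∈ wordsOfLength r (length w)
  ∈-wordsOfLength⁺ []      = here refl
  ∈-wordsOfLength⁺ (x ∷ w) = subst (x ∷ w ∈_) (sym (wordsOfLength-suc (length w)))
    (∈-cartesianProductWith⁺ _∷_ (∈-allFin x) (∈-wordsOfLength⁺ w))

  wordsOfLength-unique : ∀ m → Unique (wordsOfLength r m)
  wordsOfLength-unique zero    = [] ∷ []
  wordsOfLength-unique (suc m) = subst Unique (sym (wordsOfLength-suc m))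
    (Unique.cartesianProductWith⁺ _∷_ ∷-injective (Unique.allFin⁺ r) (wordsOfLength-unique m))

  module _ (c : Fin r → ℕ) where

    fold≡all : ∀ w (F : List (Fin r) → Bool) → F [] ≡ true →
               (∀ i is → F (i ∷ is) ≡ (occ i w ≡ᵇ c i) ∧ F is) →
               ∀ is → F is ≡ all (λ i → occ i w ≡ᵇ c i) is
    fold≡all w F F[] F∷ []       = F[]
    fold≡all w F F[] F∷ (i ∷ is) = trans (F∷ i is) (cong (_ ∧_) (fold≡all w F F[] F∷ is))

    -- inRᵇ c w folds a function local to Defs over allFin r; abstracting allFin r lets
    -- unification identify that function from its defining equations.
    inRᵇ≡all : ∀ w → inRᵇ c w ≡ all (λ i → occ i w ≡ᵇ c i) (allFin r)
    inRᵇ≡all w with allFin r | fold≡all w _ refl (λ _ _ → refl)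
    ... | is | F≡all = F≡all is

    T-inRᵇ : ∀ w → T (inRᵇ c w) ⇔ (∀ i → occ i w ≡ c i)
    T-inRᵇ w = mk⇔
      (λ T-in i → ≡ᵇ⇒≡ _ _ (All.lookup (all⁺ _ (allFin r) (subst T (inRᵇ≡all w) T-in)) (∈-allFin i)))
      (λ occ≡c → subst T (sym (inRᵇ≡all w)) (all⁻ _ (tabulate⁺ (λ i → ≡⇒≡ᵇ _ _ (occ≡c i)))))

    ∈-R⁺ : ∀ {w} → (∀ i → occ i w ≡ c i) → w ∈ R c
    ∈-R⁺ {w} occ≡c = ∈-filter⁺ (T? ∘ inRᵇ c)
      (subst (w ∈_) (cong (wordsOfLength r) length≡) (∈-wordsOfLength⁺ w)) (Equivalence.from (T-inRᵇ w) occ≡c)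
      where
      length≡ : length w ≡ sumFin c
      length≡ = trans (sym (sumFin-occ w)) (sumFin-cong occ≡c)

    ∈-R⁻ : ∀ {w} → w ∈ R c → ∀ i → occ i w ≡ c i
    ∈-R⁻ {w} w∈R =
      Equivalence.to (T-inRᵇ w) (proj₂ (∈-filter⁻ (T? ∘ inRᵇ c) {xs = wordsOfLength r (sumFin c)} w∈R))

    R-unique : Unique (R c)
    R-unique = Unique.filter⁺ (T? ∘ inRᵇ c) (wordsOfLength-unique (sumFin c))

module _ {r : ℕ} (f : List (Fin r) → List (Fin r))
         (f-injective : Injective _≡_ _≡_ f) (f-↭ : ∀ w → f w ↭ w) where

  map-R↭R : ∀ c → map f (R c) ↭ R c
  map-R↭R c =
    unique-⊆⇒↭ (Unique.map⁺ f-injective (R-unique c)) image⊆R (≤-reflexive (sym (length-map f (R c))))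
    where
    image⊆R : ∀ {v} → v ∈ map f (R c) → v ∈ R c
    image⊆R v∈fR with ∈-map⁻ f v∈fR
    ... | w , w∈R , refl = ∈-R⁺ c (λ i → trans (occ-↭ i (f-↭ w)) (∈-R⁻ c w∈R i))

  countStat-transfer : ∀ s t → (∀ w → t (f w) ≡ s w) → ∀ c n → countStat s c n ≡ countStat t c n
  countStat-transfer s t t∘f≗s c n = begin
    length (filterᵇ (λ w → s w ≡ᵇ n) (R c))
      ≡⟨ sym (length-filterᵇ-map _ _ f (λ w → cong (_≡ᵇ n) (t∘f≗s w)) (R c)) ⟩
    length (filterᵇ (λ w → t w ≡ᵇ n) (map f (R c)))
      ≡⟨ ↭-length (filter-↭ (T? ∘ (λ w → t w ≡ᵇ n)) (map-R↭R c)) ⟩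
    length (filterᵇ (λ w → t w ≡ᵇ n) (R c)) ∎
    where open ≡-Reasoning

compatible⇒equidistributed : ∀ {r} (P : OrderedBipartition r) → Compatible P → Equidistributed P
compatible⇒equidistributed P compatible =
  countStat-transfer (Φ P) (Φ-injective P) (Φ-↭ P) (majU P) (invU P) (invU-Φ P compatible)

∈⇒length≢0 : {A : Set} {x : A} {xs : List A} → x ∈ xs → length xs ≢ 0
∈⇒length≢0 (here _)  ()
∈⇒length≢0 (there _) ()

module _ {r : ℕ} (P : OrderedBipartition r) where

  χ-pair≡3 : ∀ u a̲ b̲ → χ P u + 0 + χ P a̲ + (0 + χ P b̲ + 0) ≡ 3 → a̲ ≡ true × b̲ ≡ true
  χ-pair≡3 _     true  true  _  = refl , refl
  χ-pair≡3 true  true  false ()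
  χ-pair≡3 true  false true  ()
  χ-pair≡3 true  false false ()
  χ-pair≡3 false true  false ()
  χ-pair≡3 false false true  ()
  χ-pair≡3 false false false ()

  invU-pair≡3 : ∀ a b → invU P (a ∷ b ∷ []) ≡ 3 → underlined P a ≡ true × underlined P b ≡ true
  invU-pair≡3 a b = χ-pair≡3 (U P a b) (underlined P a) (underlined P b)

  invU-pair≢3 : ∀ {x} w → length w ≡ 2 → x ∈ w → underlined P x ≡ false → invU P w ≢ 3
  invU-pair≢3 []              ()
  invU-pair≢3 (_ ∷ [])        ()
  invU-pair≢3 (_ ∷ _ ∷ _ ∷ _) ()
  invU-pair≢3 (a ∷ b ∷ []) _ (here refl)         x̲≡false inv≡3 =
    contradiction (trans (sym x̲≡false) (proj₁ (invU-pair≡3 a b inv≡3))) λ ()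
  invU-pair≢3 (a ∷ b ∷ []) _ (there (here refl)) x̲≡false inv≡3 =
    contradiction (trans (sym x̲≡false) (proj₂ (invU-pair≡3 a b inv≡3))) λ ()

  non-underlined-before-underlined : ∀ {x y} → toℕ (block P x) < toℕ (block P y) →
    underlined P x ≡ false → underlined P y ≡ true → ¬ Equidistributed P
  non-underlined-before-underlined {x} {y} x<y x̲≡false y̲≡true equidistributed =
    ∈⇒length≢0 (∈-filter⁺ _ (∈-R⁺ c {x ∷ y ∷ []} (λ _ → refl)) majU-xy≡3)
      (trans (equidistributed c 3) (cong length (filter-none _ (All.tabulate no-invU≡3))))
    where
    c : Fin r → ℕ
    c i = occ i (x ∷ y ∷ [])

    majU-xy≡3 : T (majU P (x ∷ y ∷ []) ≡ᵇ 3)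
    majU-xy≡3 rewrite ⊲-< P x<y | y̲≡true = _

    no-invU≡3 : ∀ {w} → w ∈ R c → ¬ T (invU P w ≡ᵇ 3)
    no-invU≡3 {w} w∈R = invU-pair≢3 w length≡2 x∈w x̲≡false ∘ ≡ᵇ⇒≡ _ 3
      where
      occ≡c : ∀ i → occ i w ≡ c i
      occ≡c = ∈-R⁻ c w∈R
      length≡2 : length w ≡ 2
      length≡2 = trans (sym (sumFin-occ w)) (trans (sumFin-cong occ≡c) (sumFin-occ (x ∷ y ∷ [])))
      x∈w : x ∈ w
      x∈w = occ≢0⇒∈ w (λ occ≡0 → occ-head≢0 x (y ∷ []) (trans (sym (occ≡c x)) occ≡0))

equidistributed⇒compatible : ∀ {r} (P : OrderedBipartition r) → Equidistributed P → Compatible P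
equidistributed⇒compatible P equidistributed l l′ l<l′ βl≡false with β P l′ in βl′≡true
... | false = refl
... | true with nonempty P l | nonempty P l′
...   | x , refl | y , refl =
  contradiction equidistributed (non-underlined-before-underlined P l<l′ βl≡false βl′≡true)

theorem2 : (r : ℕ) → 1 ≤ r → (P : OrderedBipartition r) →
    (Equidistributed P ⇔ Compatible P)
theorem2 r _ P = mk⇔ (equidistributed⇒compatible P) (compatible⇒equidistributed P)
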